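{- Let $D$ be a diagnoser for a partially observable plant $P$ and let $\varphi$ be an alarm condition with alarm $A$ and temporal condition $\tau=\tau(\varphi)$. Then $D$ is maximal for $\varphi$ in $P$ if and only if $D\otimes P\models G([K\tau]_o\to[A]_o)$.
   Context: An LTS is $S=\langle V,E,I,\mathcal T\rangle$ (finite set $V$ of variables over a finite domain, events $E$, initial formula $I$, transition formulas $\mathcal T(e)$ over $V\cup V'$). A trace is an infinite sequence $\sigma=s_0,e_0,s_1,e_1,\dots$ with $s_0\models I$ and $\langle s_k,s_{k+1}\rangle\models\mathcal T(e_k)$ (deadlock freedom assumed); $\sigma^k=s_0,e_0,\dots,s_k$. Deterministic: exactly one initial state and exactly one successor per event from each reachable state. A plant $P=\langle V^P,E^P,I^P,\mathcal T^P,E^P_o\rangle$ has observable events $E^P_o\subseteq E^P$. $\mathit{obs}(\sigma^k)$ = subsequence of observable events among $e_0,\dots,e_{k-1}$; $\mathit{ObsPoint}(\sigma,i)$ iff $i>0$ and $e_{i-1}\in E_o$; $((\sigma_1,i),(\sigma_2,j))\in\mathit{ObsEq}$ iff ($\mathit{ObsPoint}(\sigma_1,i)\Leftrightarrow\mathit{ObsPoint}(\sigma_2,j)$) and $\mathit{obs}(\sigma_1^i)=\mathit{obs}(\sigma_2^j)$. A diagnoser for $P$ is a deterministic LTS $D=\langle V^D,E^D,I^D,\mathcal T^D\rangle$ with $E^D=E^P_o$, $V^D\cap V^P=\emptyset$, containing Boolean alarm variables. $D\otimes P$ is the asynchronous product (variables $V^D\cup V^P$, events $E^P$, initial $I^D\wedge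 I^P$; on unobservable plant events $D$'s variables are unchanged, on observable events both move), regarded as partially observable with observable events $E^P_o$. For a trace $\sigma_P$ of $P$, $D(\sigma_P)$ is the unique trace of $D$ such that $D(\sigma_P)\otimes\sigma_P$ is a trace of $D\otimes P$ (positions of this combined trace match those of $\sigma_P$). Logic: LTL with past (reflexive; $Y\beta$ at $i$ iff $i>0$ and $\beta$ at $i-1$; $O$ = once in the past including now; $O^{\le n}\beta=\beta\vee Y\beta\vee\dots\vee Y^n\beta$; $\sigma,i\models e$ iff $e_i=e$) extended with $K$: $\sigma_1,i\models K\beta$ iff for every trace $\sigma_2$ of the system and every $j$ with $((\sigma_1,i),(\sigma_2,j))\in\mathit{ObsEq}$, $\sigma_2,j\models\beta$. $[\phi]_o$ abbreviates $\phi\wedge Y\bigvee_{e\in E_o}e$. A system satisfies a formula iff all its traces do at position 0. Alarm conditions for a diagnosis condition $\beta$ (formula over plant propositions built with $\wedge,\neg,O,Y$) and delay $d$: $\mathrm{ExactDel}(A,\beta,d)$ with $\tau=Y^d\beta$; $\mathrm{BoundDel}(A,\beta,d)$ with $\tau=O^{\le d}\beta$; $\mathrm{FiniteDel}(A,\beta)$ with $\tau=O\beta$. A diagnoser $D'$ (with alarm variable $A$) is correct for $\varphi$ if $D'\otimes P\models G([A]_o\to\tau)$. Maximality: $D$ is maximal for $\varphi$ in $P$ iff for every trace $\sigma_P$ of $P$ and every observation point $i$ of $\sigma_P$, if $A$ is false at position $i$ of $D(\sigma_P)\otimes\sigma_P$, then there is no diagnoser $D'$ of $P$ that is correct for $\varphi$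 and such that $A$ is true at position $i$ of $D'(\sigma_P)\otimes\sigma_P$. -}

module Defs where

open import Data.Nat using (ℕ; zero; suc; _≤_; _<_)
open import Data.Fin using (Fin)
open import Data.Bool using (Bool; true; false; T; if_then_else_)
open import Data.List using (List; []; _∷_; _++_)
open import Data.Product using (Σ; Σ-syntax; _×_; _,_; proj₁; proj₂; ∃!)
open import Data.Sum using (_⊎_)
open import Data.Empty using (⊥)
open import Relation.Nullary using (¬_)
open import Relation.Binary.PropositionalEquality using (_≡_)
open import Function.Bundles using (_↔_)

Finite : Set → Set
Finite A = Σ ℕ λ n → A ↔ Fin n

record LTS : Set₁ where
  field
    State : Set
    Event : Set
    Init  : State → Set
    Trans : Event → State → State → Set
open LTS public

record Trace (L : LTS) : Set where
  field
    st   : ℕ → State L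
    ev   : ℕ → Event L
    init : Init L (st 0)
    step : ∀ k → Trans L (ev k) (st k) (st (suc k))
open Trace public

data Reachable (L : LTS) : State L → Set where
  initR : ∀ {s} → Init L s → Reachable L s
  stepR : ∀ {s s' e} → Reachable L s → Trans L e s s' → Reachable L s'

Deterministic : LTS → Set
Deterministic L =
  ∃! _≡_ (λ s → Init L s) ×
  (∀ s → Reachable L s → ∀ e → ∃! _≡_ (λ s' → Trans L e s s'))

DeadlockFree : LTS → Set
DeadlockFree L = ∀ s → Reachable L s → Σ (Event L) λ e → Σ (State L) λ s' → Trans L e s s'

record POSys : Set₁ where
  field
    lts : LTS
    obs : Event lts → Bool
open POSys public

record Plant : Set₁ where
  field
    PState  : Set
    PEvent  : Set
    PStateFinite : Finite PState
    PEventFinite : Finite PEvent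
    PInit   : PState → Bool
    PTrans  : PEvent → PState → PState → Bool
    PObs    : PEvent → Bool
open Plant public

plantLTS : Plant → LTS
plantLTS P = record
  { State = PState P ; Event = PEvent P
  ; Init = λ s → T (PInit P s)
  ; Trans = λ e s s' → T (PTrans P e s s') }

ObsEvent : Plant → Set
ObsEvent P = Σ (PEvent P) λ e → T (PObs P e)

-- Disjointness of variables is automatic (product of state types).
record Diagnoser (P : Plant) : Set₁ where
  field
    DState  : Set
    DStateFinite : Finite DState
    DInit   : DState → Bool
    DTrans  : ObsEvent P → DState → DState → Bool
    alarm   : DState → Bool
  dLTS : LTS
  dLTS = record
    { State = DState ; Event = ObsEvent P
    ; Init = λ s → T (DInit s)
    ; Trans = λ e s s' → T (DTrans e s s') }
  field
    deterministic : Deterministic dLTS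
open Diagnoser public

prodLTS : (P : Plant) → Diagnoser P → LTS
prodLTS P D = record
  { State = DState D × PState P
  ; Event = PEvent P
  ; Init  = λ { (d , p) → T (DInit D d) × T (PInit P p) }
  ; Trans = λ e → λ { (d , p) (d' , p') →
        T (PTrans P e p p')
      × ((o : T (PObs P e)) → T (DTrans D (e , o) d d'))
      × (¬ T (PObs P e) → d ≡ d') } }

prod : (P : Plant) → Diagnoser P → POSys
prod P D = record { lts = prodLTS P D ; obs = PObs P }

module _ (S : POSys) where
  private L = lts S

  obsSeq : Trace L → ℕ → List (Event L)
  obsSeq σ zero    = []
  obsSeq σ (suc k) = obsSeq σ k ++ (if obs S (ev σ k) then ev σ k ∷ [] else [])

  ObsPoint : Trace L → ℕ → Set
  ObsPoint σ zero    = ⊥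
  ObsPoint σ (suc i) = T (obs S (ev σ i))

  ObsEq : Trace L → ℕ → Trace L → ℕ → Set
  ObsEq σ₁ i σ₂ j =
    ((ObsPoint σ₁ i → ObsPoint σ₂ j) × (ObsPoint σ₂ j → ObsPoint σ₁ i))
    × obsSeq σ₁ i ≡ obsSeq σ₂ j

data Formula (St Ev : Set) : Set where
  atom  : (St → Bool) → Formula St Ev
  event : Ev → Formula St Ev
  evIn  : (Ev → Bool) → Formula St Ev
  ¬'_   : Formula St Ev → Formula St Ev
  _∧'_  : Formula St Ev → Formula St Ev → Formula St Ev
  _∨'_  : Formula St Ev → Formula St Ev → Formula St Ev
  _⇒'_  : Formula St Ev → Formula St Ev → Formula St Ev
  Y     : Formula St Ev → Formula St Ev
  O     : Formula St Ev → Formula St Ev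
  G     : Formula St Ev → Formula St Ev
  K     : Formula St Ev → Formula St Ev

Yⁿ : ∀ {St Ev} → ℕ → Formula St Ev → Formula St Ev
Yⁿ zero    β = β
Yⁿ (suc n) β = Y (Yⁿ n β)

O≤ : ∀ {St Ev} → ℕ → Formula St Ev → Formula St Ev
O≤ zero    β = β
O≤ (suc n) β = O≤ n β ∨' Yⁿ (suc n) β

[_]ₒ : (S : POSys) → Formula (State (lts S)) (Event (lts S))
     → Formula (State (lts S)) (Event (lts S))
[ S ]ₒ φ = φ ∧' Y (evIn (obs S))

mapF : ∀ {St St' Ev} → (St' → St) → Formula St Ev → Formula St' Ev
mapF f (atom p)  = atom (λ s → p (f s))
mapF f (event e) = event e
mapF f (evIn X)  = evIn X
mapF f (¬' φ)    = ¬' mapF f φ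
mapF f (φ ∧' ψ)  = mapF f φ ∧' mapF f ψ
mapF f (φ ∨' ψ)  = mapF f φ ∨' mapF f ψ
mapF f (φ ⇒' ψ)  = mapF f φ ⇒' mapF f ψ
mapF f (Y φ)     = Y (mapF f φ)
mapF f (O φ)     = O (mapF f φ)
mapF f (G φ)     = G (mapF f φ)
mapF f (K φ)     = K (mapF f φ)

module _ (S : POSys) where
  private L = lts S

  Sat : Trace L → ℕ → Formula (State L) (Event L) → Set
  Sat σ i (atom p)  = T (p (st σ i))
  Sat σ i (event e) = ev σ i ≡ e
  Sat σ i (evIn X)  = T (X (ev σ i))
  Sat σ i (¬' φ)    = ¬ Sat σ i φ
  Sat σ i (φ ∧' ψ)  = Sat σ i φ × Sat σ i ψ
  Sat σ i (φ ∨' ψ)  = Sat σ i φ ⊎ Sat σ i ψ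
  Sat σ i (φ ⇒' ψ)  = Sat σ i φ → Sat σ i ψ
  Sat σ zero    (Y φ) = ⊥
  Sat σ (suc i) (Y φ) = Sat σ i φ
  Sat σ i (O φ)     = Σ ℕ λ k → k ≤ i × Sat σ k φ
  Sat σ i (G φ)     = ∀ j → i ≤ j → Sat σ j φ
  Sat σ i (K φ)     = ∀ (σ₂ : Trace L) j → ObsEq S σ i σ₂ j → Sat σ₂ j φ

  Models : Formula (State L) (Event L) → Set
  Models φ = ∀ (σ : Trace L) → Sat σ 0 φ

data DiagCond (P : Plant) : Set where
  patom  : (PState P → Bool) → DiagCond P
  pevent : PEvent P → DiagCond P
  _∧ᵈ_   : DiagCond P → DiagCond P → DiagCond P
  ¬ᵈ_    : DiagCond P → DiagCond P
  Oᵈ     : DiagCond P → DiagCond P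
  Yᵈ     : DiagCond P → DiagCond P

toFormula : {P : Plant} → DiagCond P → Formula (PState P) (PEvent P)
toFormula (patom p)  = atom p
toFormula (pevent e) = event e
toFormula (β ∧ᵈ γ)   = toFormula β ∧' toFormula γ
toFormula (¬ᵈ β)     = ¬' toFormula β
toFormula (Oᵈ β)     = O (toFormula β)
toFormula (Yᵈ β)     = Y (toFormula β)

data AlarmCond (P : Plant) : Set where
  ExactDel  : DiagCond P → ℕ → AlarmCond P
  BoundDel  : DiagCond P → ℕ → AlarmCond P
  FiniteDel : DiagCond P → AlarmCond P

τ : {P : Plant} → AlarmCond P → Formula (PState P) (PEvent P)
τ (ExactDel β d) = Yⁿ d (toFormula β)
τ (BoundDel β d) = O≤ d (toFormula β)
τ (FiniteDel β)  = O (toFormula β)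

τ⊗ : {P : Plant} (D : Diagnoser P) → AlarmCond P
   → Formula (State (prodLTS P D)) (Event (prodLTS P D))
τ⊗ D φ = mapF proj₂ (τ φ)

A⊗ : {P : Plant} (D : Diagnoser P)
   → Formula (State (prodLTS P D)) (Event (prodLTS P D))
A⊗ D = atom (λ s → alarm D (proj₁ s))

Correct : (P : Plant) → Diagnoser P → AlarmCond P → Set
Correct P D φ = Models (prod P D) (G (([ prod P D ]ₒ (A⊗ D)) ⇒' τ⊗ D φ))

-- ρ is the combined trace D(σ_P) ⊗ σ_P : its plant component is σ_P
-- (for a diagnoser this trace exists and is unique)
IsCombined : {P : Plant} (D : Diagnoser P) → Trace (prodLTS P D)
           → Trace (plantLTS P) → Set
IsCombined D ρ σP = (∀ k → ev ρ k ≡ ev σP k) × (∀ k → proj₂ (st ρ k) ≡ st σP k)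

PObsPoint : (P : Plant) → Trace (plantLTS P) → ℕ → Set
PObsPoint P σ zero    = ⊥
PObsPoint P σ (suc i) = T (PObs P (ev σ i))

Maximal : (P : Plant) → Diagnoser P → AlarmCond P → Set₁
Maximal P D φ =
  ∀ (σP : Trace (plantLTS P)) (i : ℕ) → PObsPoint P σP i →
  ∀ (ρ : Trace (prodLTS P D)) → IsCombined D ρ σP →
  alarm D (proj₁ (st ρ i)) ≡ false →
  ¬ (Σ (Diagnoser P) λ D' → Correct P D' φ ×
       Σ (Trace (prodLTS P D')) λ ρ' → IsCombined D' ρ' σP ×
         alarm D' (proj₁ (st ρ' i)) ≡ true)

-- The state of a deterministic diagnoser is a function of the observation word. Hence a correct
-- diagnoser that alarms at some point also alarms at every observationally equivalent point of any
-- trace, where τ must then hold: its alarm can only be raised where τ is known. Conversely, if τ is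
-- known after the observation word w, the diagnoser that alarms exactly when it has observed w is
-- correct and alarms there, so a maximal diagnoser must alarm whenever τ is known.

module Submission where

open import Defs
open import Function using (_∘_)
open import Function.Bundles using (_⇔_; mk⇔; Equivalence; _↔_; mk↔ₛ′)
open import Function.Properties.Inverse using (↔⇒↣)
open import Data.Nat using (ℕ; zero; suc; z≤n)
open import Data.Fin using (Fin; zero; suc)
import Data.Fin.Properties as Fin
open import Data.Bool using (Bool; true; false; T; if_then_else_)
open import Data.Bool.Properties using (T?; T-≡; T-irrelevant)
open import Data.List using (List; []; _∷_; _++_; foldl; length; null)
open import Data.List.Properties using (foldl-++; ∷-injectiveˡ; ∷-injectiveʳ)
open import Data.Maybe using (Maybe; just; nothing)
import Data.Maybe as Maybe
open import Data.Maybe.Properties using (≡-dec)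
open import Data.Product using (Σ; Σ-syntax; _×_; _,_; proj₁; proj₂)
open import Data.Sum using (inj₁; inj₂)
open import Data.Empty using (⊥-elim)
open import Relation.Nullary using (¬_; yes; no)
open import Relation.Nullary.Decidable using (⌊_⌋; toWitness; fromWitness)
open import Relation.Binary.Definitions using (DecidableEquality)
open import Relation.Binary.PropositionalEquality
open ≡-Reasoning

open Equivalence using (to; from)

data KFree {St Ev : Set} : Formula St Ev → Set where
  atom  : ∀ p → KFree (atom p)
  event : ∀ e → KFree (event e)
  evIn  : ∀ X → KFree (evIn X)
  ¬'_   : ∀ {φ} → KFree φ → KFree (¬' φ)
  _∧'_  : ∀ {φ ψ} → KFree φ → KFree ψ → KFree (φ ∧' ψ)
  _∨'_  : ∀ {φ ψ} → KFree φ → KFree ψ → KFree (φ ∨' ψ)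
  _⇒'_  : ∀ {φ ψ} → KFree φ → KFree ψ → KFree (φ ⇒' ψ)
  Y     : ∀ {φ} → KFree φ → KFree (Y φ)
  O     : ∀ {φ} → KFree φ → KFree (O φ)
  G     : ∀ {φ} → KFree φ → KFree (G φ)

toFormula-KFree : ∀ {P} (β : DiagCond P) → KFree (toFormula β)
toFormula-KFree (patom p)  = atom p
toFormula-KFree (pevent e) = event e
toFormula-KFree (β ∧ᵈ γ)   = toFormula-KFree β ∧' toFormula-KFree γ
toFormula-KFree (¬ᵈ β)     = ¬' toFormula-KFree β
toFormula-KFree (Oᵈ β)     = O (toFormula-KFree β)
toFormula-KFree (Yᵈ β)     = Y (toFormula-KFree β)

Yⁿ-KFree : ∀ {St Ev} n {β : Formula St Ev} → KFree β → KFree (Yⁿ n β)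
Yⁿ-KFree zero    β = β
Yⁿ-KFree (suc n) β = Y (Yⁿ-KFree n β)

O≤-KFree : ∀ {St Ev} n {β : Formula St Ev} → KFree β → KFree (O≤ n β)
O≤-KFree zero    β = β
O≤-KFree (suc n) β = O≤-KFree n β ∨' Y (Yⁿ-KFree n β)

τ-KFree : ∀ {P} (φ : AlarmCond P) → KFree (τ φ)
τ-KFree (ExactDel β d) = Yⁿ-KFree d (toFormula-KFree β)
τ-KFree (BoundDel β d) = O≤-KFree d (toFormula-KFree β)
τ-KFree (FiniteDel β)  = O (toFormula-KFree β)

Y-evIn-obs⇔ObsPoint : ∀ S (σ : Trace (lts S)) i → Sat S σ i (Y (evIn (obs S))) ⇔ ObsPoint S σ i
Y-evIn-obs⇔ObsPoint S σ zero    = mk⇔ (λ ()) (λ ())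
Y-evIn-obs⇔ObsPoint S σ (suc i) = mk⇔ (λ o → o) (λ o → o)

plantSys : Plant → POSys
plantSys P = record { lts = plantLTS P ; obs = PObs P }

module _ (P : Plant) where

  observed : PEvent P → List (PEvent P)
  observed e = if PObs P e then e ∷ [] else []

  observed-obs : ∀ {e} → T (PObs P e) → observed e ≡ e ∷ []
  observed-obs o rewrite to T-≡ o = refl

  observed-unobs : ∀ {e} → ¬ T (PObs P e) → observed e ≡ []
  observed-unobs {e} ¬o with PObs P e
  ... | true  = ⊥-elim (¬o _)
  ... | false = refl

  foldl-observed : ∀ {S : Set} (g : S → PEvent P → S) s e (Q : S → Set) →
    (T (PObs P e) → Q (g s e)) → (¬ T (PObs P e) → Q s) → Q (foldl g s (observed e))
  foldl-observed g s e Q obs unobs with T? (PObs P e)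
  ... | yes o  rewrite observed-obs o    = obs o
  ... | no  ¬o rewrite observed-unobs ¬o = unobs ¬o

module _ {P : Plant} (D : Diagnoser P) where

  plantOf : Trace (prodLTS P D) → Trace (plantLTS P)
  plantOf ρ = record
    { st = λ k → proj₂ (st ρ k) ; ev = ev ρ
    ; init = proj₂ (init ρ) ; step = λ k → proj₁ (step ρ k) }

  isCombined-plantOf : (ρ : Trace (prodLTS P D)) → IsCombined D ρ (plantOf ρ)
  isCombined-plantOf ρ = (λ _ → refl) , (λ _ → refl)

  module _ (ρ : Trace (prodLTS P D)) (σP : Trace (plantLTS P)) (c : IsCombined D ρ σP) where

    obsSeq-combined : ∀ k → obsSeq (prod P D) ρ k ≡ obsSeq (plantSys P) σP k
    obsSeq-combined zero    = refl
    obsSeq-combined (suc k) = cong₂ _++_ (obsSeq-combined k) (cong (observed P) (proj₁ c k))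

    ObsPoint-combined : ∀ i → ObsPoint (prod P D) ρ i ⇔ PObsPoint P σP i
    ObsPoint-combined zero    = mk⇔ (λ ()) (λ ())
    ObsPoint-combined (suc i) =
      mk⇔ (subst (T ∘ PObs P) (proj₁ c i)) (subst (T ∘ PObs P) (sym (proj₁ c i)))

    sat-combined : ∀ {ψ} → KFree ψ → ∀ i →
      Sat (prod P D) ρ i (mapF proj₂ ψ) ⇔ Sat (plantSys P) σP i ψ
    sat-combined (atom p)  i = mk⇔ (subst (T ∘ p) (proj₂ c i)) (subst (T ∘ p) (sym (proj₂ c i)))
    sat-combined (event e) i = mk⇔ (trans (sym (proj₁ c i))) (trans (proj₁ c i))
    sat-combined (evIn X)  i = mk⇔ (subst (T ∘ X) (proj₁ c i)) (subst (T ∘ X) (sym (proj₁ c i)))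
    sat-combined (¬' φ) i = mk⇔
      (λ ¬s s → ¬s (from (sat-combined φ i) s))
      (λ ¬s s → ¬s (to (sat-combined φ i) s))
    sat-combined (φ ∧' ψ) i = mk⇔
      (λ (s , t) → to (sat-combined φ i) s , to (sat-combined ψ i) t)
      (λ (s , t) → from (sat-combined φ i) s , from (sat-combined ψ i) t)
    sat-combined (φ ∨' ψ) i = mk⇔
      (λ { (inj₁ s) → inj₁ (to (sat-combined φ i) s)
         ; (inj₂ t) → inj₂ (to (sat-combined ψ i) t) })
      (λ { (inj₁ s) → inj₁ (from (sat-combined φ i) s)
         ; (inj₂ t) → inj₂ (from (sat-combined ψ i) t) })
    sat-combined (φ ⇒' ψ) i = mk⇔
      (λ f s → to (sat-combined ψ i) (f (from (sat-combined φ i) s)))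
      (λ f s → from (sat-combined ψ i) (f (to (sat-combined φ i) s)))
    sat-combined (Y φ) zero    = mk⇔ (λ ()) (λ ())
    sat-combined (Y φ) (suc i) = sat-combined φ i
    sat-combined (O φ) i = mk⇔
      (λ (k , k≤i , s) → k , k≤i , to (sat-combined φ k) s)
      (λ (k , k≤i , s) → k , k≤i , from (sat-combined φ k) s)
    sat-combined (G φ) i = mk⇔
      (λ g j i≤j → to (sat-combined φ j) (g j i≤j))
      (λ g j i≤j → from (sat-combined φ j) (g j i≤j))

module _ {P : Plant} where

  DStep : (D : Diagnoser P) → PEvent P → DState D → DState D → Set
  DStep D e d d' = ((o : T (PObs P e)) → T (DTrans D (e , o) d d')) × (¬ T (PObs P e) → d ≡ d')

  record Tracks (D : Diagnoser P) (f : List (PEvent P) → DState D) : Set where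
    field
      tracks-init : ∀ {d} → T (DInit D d) → f [] ≡ d
      tracks-step : ∀ w e {d'} → DStep D e (f w) d' → f (w ++ observed P e) ≡ d'

  tracks-state : ∀ {D f} → Tracks D f →
    (ρ : Trace (prodLTS P D)) → ∀ k → proj₁ (st ρ k) ≡ f (obsSeq (prod P D) ρ k)
  tracks-state t ρ zero = sym (Tracks.tracks-init t (proj₁ (init ρ)))
  tracks-state {D} {f} t ρ (suc k) =
    sym (Tracks.tracks-step t (obsSeq (prod P D) ρ k) (ev ρ k) step-from-tracked)
    where
    step-from-tracked : DStep D (ev ρ k) (f (obsSeq (prod P D) ρ k)) (proj₁ (st ρ (suc k)))
    step-from-tracked = subst (λ d → DStep D (ev ρ k) d (proj₁ (st ρ (suc k))))
                              (tracks-state t ρ k) (proj₂ (step ρ k))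

module Run {P : Plant} (D : Diagnoser P) where

  ReachableState : Set
  ReachableState = Σ (DState D) (Reachable (dLTS D))

  private
    det = deterministic D

  initial : ReachableState
  initial = proj₁ (proj₁ det) , initR (proj₁ (proj₂ (proj₁ det)))

  successor : (s : ReachableState) (e : ObsEvent P) → Σ (DState D) λ d' → T (DTrans D e (proj₁ s) d')
  successor (d , r) e = proj₁ (proj₂ det d r e) , proj₁ (proj₂ (proj₂ det d r e))

  successor-unique : ∀ s e {d'} → T (DTrans D e (proj₁ s) d') → proj₁ (successor s e) ≡ d'
  successor-unique (d , r) e = proj₂ (proj₂ (proj₂ det d r e))

  next : ReachableState → PEvent P → ReachableState
  next s e with T? (PObs P e)
  ... | yes o = proj₁ (successor s (e , o)) , stepR (proj₂ s) (proj₂ (successor s (e , o)))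
  ... | no _  = s

  next-step : ∀ s e → DStep D e (proj₁ s) (proj₁ (next s e))
  next-step s e with T? (PObs P e)
  ... | yes o  = (λ o' → subst (λ o → T (DTrans D (e , o) _ _)) (T-irrelevant o o')
                                (proj₂ (successor s (e , o))))
               , (λ ¬o → ⊥-elim (¬o o))
  ... | no  ¬o = (λ o → ⊥-elim (¬o o)) , (λ _ → refl)

  next-unique : ∀ s e {d'} → DStep D e (proj₁ s) d' → proj₁ (next s e) ≡ d'
  next-unique s e (obs , unobs) with T? (PObs P e)
  ... | yes o  = successor-unique s (e , o) (obs o)
  ... | no  ¬o = unobs ¬o

  run : List (PEvent P) → ReachableState
  run = foldl next initial

  run-tracks : Tracks D (proj₁ ∘ run)
  run-tracks = record
    { tracks-init = proj₂ (proj₂ (proj₁ det))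
    ; tracks-step = λ w e {d'} step →
        trans (cong proj₁ (foldl-++ next initial w (observed P e)))
              (foldl-observed P next (run w) e (λ s → proj₁ s ≡ d')
                 (λ _ → next-unique (run w) e step) (proj₂ step)) }

  state-determined : ∀ (ρ : Trace (prodLTS P D)) i (ρ' : Trace (prodLTS P D)) j →
    obsSeq (prod P D) ρ i ≡ obsSeq (prod P D) ρ' j → proj₁ (st ρ i) ≡ proj₁ (st ρ' j)
  state-determined ρ i ρ' j same = begin
    proj₁ (st ρ i)                            ≡⟨ tracks-state run-tracks ρ i ⟩
    proj₁ (run (obsSeq (prod P D) ρ i))       ≡⟨ cong (proj₁ ∘ run) same ⟩
    proj₁ (run (obsSeq (prod P D) ρ' j))      ≡⟨ tracks-state run-tracks ρ' j ⟨
    proj₁ (st ρ' j)                           ∎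

  combined : Trace (plantLTS P) → Trace (prodLTS P D)
  combined σ = record
    { st   = λ k → proj₁ (states k) , st σ k
    ; ev   = ev σ
    ; init = proj₁ (proj₂ (proj₁ det)) , init σ
    ; step = λ k → step σ k , next-step (states k) (ev σ k) }
    where
    states : ℕ → ReachableState
    states zero    = initial
    states (suc k) = next (states k) (ev σ k)

  isCombined-combined : (σ : Trace (plantLTS P)) → IsCombined D (combined σ) σ
  isCombined-combined σ = (λ _ → refl) , (λ _ → refl)

module Recombined {P : Plant} (D D' : Diagnoser P) (ρ : Trace (prodLTS P D)) where

  ρ' : Trace (prodLTS P D')
  ρ' = Run.combined D' (plantOf D ρ)

  private
    σP = plantOf D ρ
    c  = isCombined-plantOf D ρ
    c' = Run.isCombined-combined D' σP

  obsSeq-recombined : ∀ k → obsSeq (prod P D') ρ' k ≡ obsSeq (prod P D) ρ k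
  obsSeq-recombined k = trans (obsSeq-combined D' ρ' σP c' k) (sym (obsSeq-combined D ρ σP c k))

  ObsPoint-recombined : ∀ i → ObsPoint (prod P D) ρ i → ObsPoint (prod P D') ρ' i
  ObsPoint-recombined i = from (ObsPoint-combined D' ρ' σP c' i) ∘ to (ObsPoint-combined D ρ σP c i)

  τ-recombined : ∀ (φ : AlarmCond P) i →
    Sat (prod P D') ρ' i (τ⊗ D' φ) → Sat (prod P D) ρ i (τ⊗ D φ)
  τ-recombined φ i =
    from (sat-combined D ρ σP c (τ-KFree φ) i) ∘ to (sat-combined D' ρ' σP c' (τ-KFree φ) i)

module WordRecognizer {E : Set} (_≟_ : DecidableEquality E) where

  suffix : (w : List E) → Fin (suc (length w)) → List E
  suffix w       zero    = w
  suffix (_ ∷ w) (suc k) = suffix w k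

  advance : (w : List E) → Fin (suc (length w)) → E → Maybe (Fin (suc (length w)))
  advance []      zero    e = nothing
  advance (x ∷ w) zero    e with e ≟ x
  ... | yes _ = just (suc zero)
  ... | no  _ = nothing
  advance (x ∷ w) (suc k) e = Maybe.map suc (advance w k e)

  advance-just : ∀ w k e {k'} → advance w k e ≡ just k' → suffix w k ≡ e ∷ suffix w k'
  advance-just (x ∷ w) zero e eq with e ≟ x
  advance-just (x ∷ w) zero e refl | yes refl = refl
  advance-just (x ∷ w) (suc k) e eq with advance w k e in adv
  advance-just (x ∷ w) (suc k) e refl | just k' = advance-just w k e adv

  advance-suffix : ∀ w k e {r} → suffix w k ≡ e ∷ r →
    Σ[ k' ∈ Fin (suc (length w)) ] advance w k e ≡ just k' × suffix w k' ≡ r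
  advance-suffix (x ∷ w) zero e eq with e ≟ x
  ... | yes _  = suc zero , refl , ∷-injectiveʳ eq
  ... | no e≢x = ⊥-elim (e≢x (sym (∷-injectiveˡ eq)))
  advance-suffix (x ∷ w) (suc k) e eq =
    let k' , adv , suf = advance-suffix w k e eq in suc k' , cong (Maybe.map suc) adv , suf

  module _ (w : List E) where

    -- `just k`: what has been read is w with `suffix w k` removed; `nothing`: it is not a prefix of w.
    Progress : Set
    Progress = Maybe (Fin (suc (length w)))

    read : Progress → E → Progress
    read nothing  e = nothing
    read (just k) e = advance w k e

    accepting : Progress → Bool
    accepting nothing  = false
    accepting (just k) = null (suffix w k)

    rejecting-forever : ∀ l → foldl read nothing l ≡ nothing
    rejecting-forever []      = refl
    rejecting-forever (_ ∷ l) = rejecting-forever l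

    accepting-read : ∀ l k → T (accepting (foldl read (just k) l)) ⇔ (l ≡ suffix w k)
    accepting-read l k = mk⇔ (sound l k) (complete l k)
      where
      sound : ∀ l k → T (accepting (foldl read (just k) l)) → l ≡ suffix w k
      sound [] k acc with suffix w k
      ... | [] = refl
      sound (e ∷ l) k acc with advance w k e in adv
      ... | nothing = ⊥-elim (subst (T ∘ accepting) (rejecting-forever l) acc)
      ... | just k' = trans (cong (e ∷_) (sound l k' acc)) (sym (advance-just w k e adv))
      complete : ∀ l k → l ≡ suffix w k → T (accepting (foldl read (just k) l))
      complete [] k eq rewrite sym eq = _
      complete (e ∷ l) k eq with advance-suffix w k e (sym eq)
      ... | k' , adv , suf rewrite adv = complete l k' (sym suf)

Maybe-Fin↔Fin : ∀ {n} → Maybe (Fin n) ↔ Fin (suc n)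
Maybe-Fin↔Fin = mk↔ₛ′ (Maybe.maybe suc zero) (λ { zero → nothing ; (suc k) → just k })
  (λ { zero → refl ; (suc k) → refl }) (λ { nothing → refl ; (just k) → refl })

module WordDiagnoser (P : Plant) (w : List (PEvent P)) where

  open WordRecognizer (Fin.inj⇒≟ (↔⇒↣ (proj₂ (PEventFinite P))))

  private
    _≟ₛ_ : DecidableEquality (Progress w)
    _≟ₛ_ = ≡-dec Fin._≟_

    ≟ₛ-refl : ∀ s → T ⌊ s ≟ₛ s ⌋
    ≟ₛ-refl s = fromWitness {a? = s ≟ₛ s} refl

  wordDiagnoser : Diagnoser P
  wordDiagnoser = record
    { DState = Progress w
    ; DStateFinite = _ , Maybe-Fin↔Fin
    ; DInit = λ s → ⌊ s ≟ₛ just zero ⌋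
    ; DTrans = λ e s s' → ⌊ s' ≟ₛ read w s (proj₁ e) ⌋
    ; alarm = accepting w
    ; deterministic =
        (just zero , ≟ₛ-refl (just zero) , λ s≡ → sym (toWitness s≡))
      , (λ s _ e → read w s (proj₁ e) , ≟ₛ-refl (read w s (proj₁ e))
                 , λ s≡ → sym (toWitness s≡)) }

  wordDiagnoser-tracks : Tracks wordDiagnoser (foldl (read w) (just zero))
  wordDiagnoser-tracks = record
    { tracks-init = λ s≡ → sym (toWitness s≡)
    ; tracks-step = λ v e {d'} step →
        trans (foldl-++ (read w) (just zero) v (observed P e))
              (foldl-observed P (read w) _ e (_≡ d')
                 (λ o → sym (toWitness (proj₁ step o))) (proj₂ step)) }

  alarm⇔observed-word : (ρ : Trace (prodLTS P wordDiagnoser)) → ∀ k →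
    T (alarm wordDiagnoser (proj₁ (st ρ k))) ⇔ (obsSeq (prod P wordDiagnoser) ρ k ≡ w)
  alarm⇔observed-word ρ k
    rewrite tracks-state wordDiagnoser-tracks ρ k =
      accepting-read w (obsSeq (prod P wordDiagnoser) ρ k) zero

  alarm-recombined : ∀ (D : Diagnoser P) (σ : Trace (prodLTS P D)) i → obsSeq (prod P D) σ i ≡ w →
    T (alarm wordDiagnoser (proj₁ (st (Recombined.ρ' D wordDiagnoser σ) i)))
  alarm-recombined D σ i observed-w =
    from (alarm⇔observed-word _ i) (trans (Recombined.obsSeq-recombined D wordDiagnoser σ i) observed-w)

module _ {P : Plant} (φ : AlarmCond P) where

  correct-alarm⇒Kτ : ∀ (D D' : Diagnoser P) (σP : Trace (plantLTS P))
    (ρ : Trace (prodLTS P D)) (ρ' : Trace (prodLTS P D')) i →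
    Correct P D' φ → IsCombined D ρ σP → IsCombined D' ρ' σP → ObsPoint (prod P D) ρ i →
    T (alarm D' (proj₁ (st ρ' i))) → Sat (prod P D) ρ i (K (τ⊗ D φ))
  correct-alarm⇒Kτ D D' σP ρ ρ' i correct c c' pt alarm-ρ' σ₂ j ((pt₂ , _) , same-obs) =
    τ-recombined φ j (correct ρ₂ j z≤n (alarm-ρ₂ , pt-ρ₂))
    where
    open Recombined D D' σ₂ renaming (ρ' to ρ₂)
    pt-ρ₂ : Sat (prod P D') ρ₂ j (Y (evIn (PObs P)))
    pt-ρ₂ = from (Y-evIn-obs⇔ObsPoint (prod P D') ρ₂ j) (ObsPoint-recombined j (pt₂ pt))
    alarm-ρ₂ : T (alarm D' (proj₁ (st ρ₂ j)))
    alarm-ρ₂ = subst (T ∘ alarm D') (sym (Run.state-determined D' ρ₂ j ρ' i same-obs')) alarm-ρ'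
      where
      same-obs' : obsSeq (prod P D') ρ₂ j ≡ obsSeq (prod P D') ρ' i
      same-obs' = begin
        obsSeq (prod P D') ρ₂ j   ≡⟨ obsSeq-recombined j ⟩
        obsSeq (prod P D) σ₂ j    ≡⟨ same-obs ⟨
        obsSeq (prod P D) ρ i     ≡⟨ obsSeq-combined D ρ σP c i ⟩
        obsSeq (plantSys P) σP i  ≡⟨ obsSeq-combined D' ρ' σP c' i ⟨
        obsSeq (prod P D') ρ' i   ∎

  Kτ⇒wordDiagnoser-correct : ∀ (D : Diagnoser P) (σ : Trace (prodLTS P D)) i →
    Sat (prod P D) σ i (K (τ⊗ D φ)) → ObsPoint (prod P D) σ i →
    Correct P (WordDiagnoser.wordDiagnoser P (obsSeq (prod P D) σ i)) φ
  Kτ⇒wordDiagnoser-correct D σ i Kτ pt ρ₂ k _ (alarm-ρ₂ , obs-ρ₂) =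
    τ-recombined φ k (Kτ σ₂ k (((λ _ → pt₂) , (λ _ → pt)) , same-obs))
    where
    open WordDiagnoser P (obsSeq (prod P D) σ i)
    open Recombined wordDiagnoser D ρ₂ renaming (ρ' to σ₂)
    pt₂ : ObsPoint (prod P D) σ₂ k
    pt₂ = ObsPoint-recombined k (to (Y-evIn-obs⇔ObsPoint (prod P wordDiagnoser) ρ₂ k) obs-ρ₂)
    same-obs : obsSeq (prod P D) σ i ≡ obsSeq (prod P D) σ₂ k
    same-obs = begin
      obsSeq (prod P D) σ i              ≡⟨ to (alarm⇔observed-word ρ₂ k) alarm-ρ₂ ⟨
      obsSeq (prod P wordDiagnoser) ρ₂ k ≡⟨ obsSeq-recombined k ⟨
      obsSeq (prod P D) σ₂ k             ∎

  AlarmWheneverKnown : (D : Diagnoser P) → Formula (State (prodLTS P D)) (PEvent P)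
  AlarmWheneverKnown D = G (([ prod P D ]ₒ (K (τ⊗ D φ))) ⇒' ([ prod P D ]ₒ (A⊗ D)))

  maximal⇒alarmWheneverKnown : ∀ D → Maximal P D φ → Models (prod P D) (AlarmWheneverKnown D)
  maximal⇒alarmWheneverKnown D maximal σ i _ (Kτ , obs-σ)
    with alarm D (proj₁ (st σ i)) in alarm-off
  ... | true  = _ , obs-σ
  ... | false = ⊥-elim (maximal (plantOf D σ) i ptP σ (isCombined-plantOf D σ) alarm-off
                  ( wordDiagnoser , Kτ⇒wordDiagnoser-correct D σ i Kτ pt
                  , Recombined.ρ' D wordDiagnoser σ
                  , Run.isCombined-combined wordDiagnoser (plantOf D σ)
                  , to T-≡ (alarm-recombined D σ i refl)))
    where
    open WordDiagnoser P (obsSeq (prod P D) σ i)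
    pt  = to (Y-evIn-obs⇔ObsPoint (prod P D) σ i) obs-σ
    ptP = to (ObsPoint-combined D σ (plantOf D σ) (isCombined-plantOf D σ) i) pt

  alarmWheneverKnown⇒maximal : ∀ D → Models (prod P D) (AlarmWheneverKnown D) → Maximal P D φ
  alarmWheneverKnown⇒maximal D alarmWheneverKnown σP i ptP ρ c alarm-off
                             (D' , correct , ρ' , c' , alarm-on) =
    subst T alarm-off
      (proj₁ (alarmWheneverKnown ρ i z≤n (Kτ , from (Y-evIn-obs⇔ObsPoint (prod P D) ρ i) pt)))
    where
    pt = from (ObsPoint-combined D ρ σP c i) ptP
    Kτ = correct-alarm⇒Kτ D D' σP ρ ρ' i correct c c' pt (from T-≡ alarm-on)

theorem4p1 : (P : Plant) → DeadlockFree (plantLTS P) →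
    (D : Diagnoser P) → (φ : AlarmCond P) →
    Maximal P D φ ⇔
    Models (prod P D)
    (G (([ prod P D ]ₒ (K (τ⊗ D φ))) ⇒' ([ prod P D ]ₒ (A⊗ D))))
theorem4p1 P _ D φ = mk⇔ (maximal⇒alarmWheneverKnown φ D) (alarmWheneverKnown⇒maximal φ D)
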